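{- Let $(G,\sigma)$ be a un2qBMG explained by a least-resolved tree $(T,\sigma,u)$. For every edge $xy\in E(G)$, at least one of the following holds: (i) the parent of $x$ is an ancestor of $y$ and $u(x)\neq x$; (ii) the parent of $y$ is an ancestor of $x$ and $u(y)\neq y$.
   Context: All trees are rooted (root $\rho$) and phylogenetic (every non-leaf vertex has at least two children); $L(T)$ is the leaf set; $a\preceq b$ means $a$ is a descendant of or equal to $b$; $\mathrm{lca}$ is the last common ancestor. A un2qBMG is the underlying undirected graph of a 2-colored quasi-best match graph; equivalently, a vertex-colored graph explained by some tree in the following sense. A tree $(T,\sigma,u)$ with $\sigma$ a leaf-coloring into two colors and $u(x)\in\{x,\rho\}$ for each leaf $x$ explains $(G,\sigma)$ if $V(G)=L(T)$ and for leaves $x,y$: $xy\in E(G)$ iff $\sigma(x)\neq\sigma(y)$ and either (a) $u(x)\neq x$ and $y\preceq\mathrm{lca}(x,z)$ for all leaves $z$ with $\sigma(z)=\sigma(y)$, or (b) $u(y)\neq y$ and $x\preceq\mathrm{lca}(y,z)$ for all leaves $z$ with $\sigma(z)=\sigma(x)$. A tree explaining $G$ is least-resolved if no tree $(T',\sigma,u')$ explaining $G$ has $T'$ obtained from $T$ by a nonempty sequence of contractions of internal arcs. -}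

module Defs where

open import Data.Nat using (ℕ; zero; suc)
open import Data.Fin using (Fin)
open import Data.Bool using (Bool)
open import Data.Product using (Σ; ∃; _×_; _,_)
open import Data.Sum using (_⊎_)
open import Relation.Nullary using (¬_)
open import Relation.Binary.PropositionalEquality using (_≡_; _≢_)
open import Relation.Binary.Construct.Closure.Transitive using (TransClosure)

iter : {A : Set} → (A → A) → ℕ → A → A
iter f zero    a = a
iter f (suc k) a = f (iter f k a)

-- Vertices are Fin n; every vertex except the root has a parent; the root is
-- the unique fixed point of `parent` and is reached from every vertex.
record Tree (m : ℕ) : Set where
  field
    n          : ℕ
    root       : Fin n
    parent     : Fin n → Fin n
    parentRoot : parent root ≡ root
    reachRoot  : ∀ v → ∃ λ k → iter parent k v ≡ root

  Child : Fin n → Fin n → Set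
  Child w v = (w ≢ root) × (parent w ≡ v)

  IsLeaf : Fin n → Set
  IsLeaf v = ∀ w → ¬ Child w v

  field
    phylo      : ∀ v w → Child w v → ∃ λ w' → Child w' v × w' ≢ w
    leaf       : Fin m → Fin n
    leafInj    : ∀ x y → leaf x ≡ leaf y → x ≡ y
    leafIsLeaf : ∀ x → IsLeaf (leaf x)
    leafSurj   : ∀ v → IsLeaf v → ∃ λ x → leaf x ≡ v

  _⪯_ : Fin n → Fin n → Set
  a ⪯ b = ∃ λ k → iter parent k a ≡ b

  IsLCA : Fin n → Fin n → Fin n → Set
  IsLCA a b w = (a ⪯ w) × (b ⪯ w) × (∀ w' → a ⪯ w' → b ⪯ w' → w ⪯ w')

open Tree public

-- A truncation map u with u(x) ∈ {x, ρ} is a function Fin m → vertices.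
CondA : ∀ {m} (T : Tree m) (σ : Fin m → Bool) (u : Fin m → Fin (n T)) →
        Fin m → Fin m → Set
CondA T σ u x y =
  (u x ≢ leaf T x) ×
  (∀ z → σ z ≡ σ y → ∀ w → IsLCA T (leaf T x) (leaf T z) w → _⪯_ T (leaf T y) w)

ValidU : ∀ {m} (T : Tree m) → (Fin m → Fin (n T)) → Set
ValidU T u = ∀ x → (u x ≡ leaf T x) ⊎ (u x ≡ root T)

Graph : ℕ → Set₁
Graph m = Fin m → Fin m → Set

Explains : ∀ {m} (T : Tree m) (σ : Fin m → Bool) (u : Fin m → Fin (n T)) →
           Graph m → Set
Explains T σ u E =
  ValidU T u ×
  (∀ x y → (E x y → (σ x ≢ σ y) × (CondA T σ u x y ⊎ CondA T σ u y x))
         × ((σ x ≢ σ y) × (CondA T σ u x y ⊎ CondA T σ u y x) → E x y))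

-- T' is obtained from T by contracting a single internal arc (parent c, c),
-- where c is an inner (non-leaf) non-root vertex.
record ContractStep {m} (T T' : Tree m) : Set where
  field
    c        : Fin (n T)
    cNotRoot : c ≢ root T
    cInner   : ¬ IsLeaf T c
    e        : Fin (n T') → Fin (n T)
    eInj     : ∀ a b → e a ≡ e b → a ≡ b
    eMiss    : ∀ a → e a ≢ c
    eOnto    : ∀ v → v ≢ c → ∃ λ a → e a ≡ v
    eRoot    : e (root T') ≡ root T
    eLeaf    : ∀ x → e (leaf T' x) ≡ leaf T x
    eParent  : ∀ a → a ≢ root T' →
                 (parent T (e a) ≢ c → e (parent T' a) ≡ parent T (e a)) ×
                 (parent T (e a) ≡ c → e (parent T' a) ≡ parent T c)

Contracts : ∀ {m} → Tree m → Tree m → Set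
Contracts = TransClosure ContractStep

LeastResolved : ∀ {m} (T : Tree m) (σ : Fin m → Bool) (u : Fin m → Fin (n T)) →
                Graph m → Set
LeastResolved {m} T σ u E =
  Explains T σ u E ×
  (∀ (T' : Tree m) (u' : Fin m → Fin (n T')) → Contracts T T' → ¬ Explains T' σ u' E)

module Submission where

-- Suppose an edge xy holds by condition (a) but y is not below the parent c of x.
-- No leaf z of colour σ(y) lies below c, for otherwise c = lca(x, z) and (a)
-- would put y below c. Hence all leaves below c have the colour σ(x), so c is
-- the lca of no two differently coloured leaves, and these are the only lcas
-- that the definition of "explains" inspects. Contracting the arc above c
-- therefore yields a tree that still explains G, contradicting least-resolvedness.

open import Defs
open import Data.Nat using (zero; suc; pred; _+_; _≤′_; ≤′-refl; ≤′-step; _≤?_; s≤s)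
open import Data.Nat.Properties using (≤⇒≤′; ≰⇒≥)
open import Data.Fin using (Fin; toℕ; fromℕ; fromℕ<; punchIn; punchOut; _≟_)
open import Data.Fin.Properties using (any?; toℕ-fromℕ; toℕ-fromℕ<; punchIn-injective; punchInᵢ≢i; punchIn-punchOut)
open import Data.Bool using (Bool)
open import Data.Bool.Properties using (¬-not)
open import Data.Product using (∃; _×_; _,_; proj₁; proj₂)
open import Data.Sum using (_⊎_; inj₁; inj₂; [_,_]′)
open import Data.Sum.Function.Propositional using (_⊎-cong_)
open import Function using (_∘_)
open import Function.Bundles using (_⇔_; mk⇔; Equivalence)
open import Relation.Nullary using (¬_; Dec; yes; no; contradiction)
open import Relation.Nullary.Decidable using (map′)
open import Relation.Binary.Definitions using (DecidableEquality)
open import Relation.Binary.PropositionalEquality using (_≡_; _≢_; refl; sym; trans; cong; subst; module ≡-Reasoning)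
open import Relation.Binary.Construct.Closure.Transitive using ([_])

Reach : {A : Set} → (A → A) → A → A → Set
Reach f a b = ∃ λ k → iter f k a ≡ b

module _ {A : Set} (f : A → A) where

  iter-+ : ∀ k j a → iter f (k + j) a ≡ iter f k (iter f j a)
  iter-+ zero    j a = refl
  iter-+ (suc k) j a = cong f (iter-+ k j a)

  iter-sucʳ : ∀ k a → iter f (suc k) a ≡ iter f k (f a)
  iter-sucʳ zero    a = refl
  iter-sucʳ (suc k) a = cong f (iter-sucʳ k a)

  iter-fixed : ∀ {r} → f r ≡ r → ∀ k → iter f k r ≡ r
  iter-fixed fr zero    = refl
  iter-fixed fr (suc k) = trans (cong f (iter-fixed fr k)) fr

  iter-stable : ∀ {r} → f r ≡ r → ∀ {a j k} → j ≤′ k → iter f j a ≡ r → iter f k a ≡ r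
  iter-stable fr ≤′-refl       e = e
  iter-stable fr (≤′-step j≤k) e = trans (cong f (iter-stable fr j≤k e)) fr

  Reach-refl : ∀ a → Reach f a a
  Reach-refl a = 0 , refl

  Reach-trans : ∀ {a b c} → Reach f a b → Reach f b c → Reach f a c
  Reach-trans {a} (j , refl) (k , refl) = k + j , iter-+ k j a

  Reach-step : ∀ {a b} → Reach f (f a) b → Reach f a b
  Reach-step {a} (k , e) = suc k , trans (iter-sucʳ k a) e

  -- Once a reaches a fixed point r in K steps, only the first K + 1 iterates need checking.
  Reach-dec : DecidableEquality A → ∀ {r a} → f r ≡ r → Reach f a r → ∀ b → Dec (Reach f a b)
  Reach-dec _≟ᴬ_ {r} {a} fr (K , aK) b =
    map′ (λ (i , e) → toℕ i , e) bounded (any? λ (i : Fin (suc K)) → iter f (toℕ i) a ≟ᴬ b)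
    where
    bounded : Reach f a b → ∃ λ (i : Fin (suc K)) → iter f (toℕ i) a ≡ b
    bounded (k , e) with k ≤? K
    ... | yes k≤K = fromℕ< (s≤s k≤K) , trans (cong (λ j → iter f j a) (toℕ-fromℕ< (s≤s k≤K))) e
    ... | no k≰K  = fromℕ K , (begin
      iter f (toℕ (fromℕ K)) a  ≡⟨ cong (λ j → iter f j a) (toℕ-fromℕ K) ⟩
      iter f K a                ≡⟨ aK ⟩
      r                         ≡⟨ sym (iter-stable fr (≤⇒≤′ (≰⇒≥ k≰K)) aK) ⟩
      iter f k a                ≡⟨ e ⟩
      b                         ∎)
      where open ≡-Reasoning

Monochromatic : ∀ {m} (T : Tree m) → (Fin m → Bool) → Fin (n T) → Set
Monochromatic T σ v = ∀ p q → _⪯_ T (leaf T p) v → _⪯_ T (leaf T q) v → σ p ≡ σ q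

module _ {m} (T : Tree m) where

  ⪯-dec : ∀ a b → Dec (_⪯_ T a b)
  ⪯-dec a = Reach-dec (parent T) _≟_ (parentRoot T) (reachRoot T a)

  parent≢self : ∀ {v} → v ≢ root T → parent T v ≢ v
  parent≢self {v} v≢root pv≡v with reachRoot T v
  ... | k , e = v≢root (trans (sym (iter-fixed (parent T) pv≡v k)) e)

  child≢parent : ∀ {w v} → Child T w v → w ≢ v
  child≢parent (w≢root , refl) w≡pw = parent≢self w≢root (sym w≡pw)

  ⪯-leaf⇒≡ : ∀ {a} x → _⪯_ T a (leaf T x) → a ≡ leaf T x
  ⪯-leaf⇒≡ {a} x (k , e) = go k e
    where
    go : ∀ k → iter (parent T) k a ≡ leaf T x → a ≡ leaf T x
    go zero    e = e
    go (suc k) e with iter (parent T) k a ≟ root T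
    ... | no  ≢root = contradiction (≢root , e) (leafIsLeaf T x _)
    ... | yes ≡root = go k (trans ≡root (trans (sym (parentRoot T)) (trans (cong (parent T) (sym ≡root)) e)))

  IsLCA-parent : ∀ {x z} → z ≢ x → _⪯_ T (leaf T z) (parent T (leaf T x)) →
                 IsLCA T (leaf T x) (leaf T z) (parent T (leaf T x))
  IsLCA-parent {x} {z} z≢x z⪯px = (1 , refl) , z⪯px , least
    where
    least : ∀ V → _⪯_ T (leaf T x) V → _⪯_ T (leaf T z) V → _⪯_ T (parent T (leaf T x)) V
    least V (zero , refl) z⪯x = contradiction (leafInj T z x (⪯-leaf⇒≡ x z⪯x)) z≢x
    least V (suc k , e)   _   = k , trans (sym (iter-sucʳ (parent T) k (leaf T x))) e

-- punchIn and punchOut for a Fin N whose size is not syntactically a successor.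
punchIn′ : ∀ {N} → Fin N → Fin (pred N) → Fin N
punchIn′ {suc N} = punchIn

punchOut′ : ∀ {N} {i j : Fin N} → j ≢ i → Fin (pred N)
punchOut′ {suc N} j≢i = punchOut (j≢i ∘ sym)

punchIn′-punchOut′ : ∀ {N} {i j : Fin N} (j≢i : j ≢ i) → punchIn′ i (punchOut′ j≢i) ≡ j
punchIn′-punchOut′ {suc N} j≢i = punchIn-punchOut (j≢i ∘ sym)

punchIn′-injective : ∀ {N} (i : Fin N) {a b} → punchIn′ i a ≡ punchIn′ i b → a ≡ b
punchIn′-injective {suc N} i = punchIn-injective i _ _

punchIn′ᵢ≢i : ∀ {N} (i : Fin N) a → punchIn′ i a ≢ i
punchIn′ᵢ≢i {suc N} = punchInᵢ≢i

module Contraction {m} (T : Tree m) {c g : Fin (n T)} (c≢root : c ≢ root T) (g◁c : Child T g c) where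

  ι : Fin (pred (n T)) → Fin (n T)
  ι = punchIn′ c

  ι-injective : ∀ {a b} → ι a ≡ ι b → a ≡ b
  ι-injective = punchIn′-injective c

  ι≢c : ∀ a → ι a ≢ c
  ι≢c = punchIn′ᵢ≢i c

  ι⁻¹ : ∀ {v} → v ≢ c → Fin (pred (n T))
  ι⁻¹ = punchOut′

  ι-ι⁻¹ : ∀ {v} (v≢c : v ≢ c) → ι (ι⁻¹ v≢c) ≡ v
  ι-ι⁻¹ = punchIn′-punchOut′

  ι-onto : ∀ {v} → v ≢ c → ∃ λ a → ι a ≡ v
  ι-onto v≢c = ι⁻¹ v≢c , ι-ι⁻¹ v≢c

  leaf≢c : ∀ x → leaf T x ≢ c
  leaf≢c x refl = leafIsLeaf T x g g◁c

  skip : Fin (n T) → Fin (n T)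
  skip v with parent T v ≟ c
  ... | yes _ = parent T c
  ... | no  _ = parent T v

  skip-≡ : ∀ {v} → parent T v ≡ c → skip v ≡ parent T c
  skip-≡ {v} pv≡c with parent T v ≟ c
  ... | yes _    = refl
  ... | no  pv≢c = contradiction pv≡c pv≢c

  skip-≢ : ∀ {v} → parent T v ≢ c → skip v ≡ parent T v
  skip-≢ {v} pv≢c with parent T v ≟ c
  ... | yes pv≡c = contradiction pv≡c pv≢c
  ... | no  _    = refl

  skip≢c : ∀ v → skip v ≢ c
  skip≢c v with parent T v ≟ c
  ... | yes _    = parent≢self T c≢root
  ... | no  pv≢c = pv≢c

  ⪯-skip : ∀ v → _⪯_ T v (skip v)
  ⪯-skip v with parent T v ≟ c
  ... | yes refl = 2 , refl
  ... | no  _    = 1 , refl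

  parent′ : Fin (pred (n T)) → Fin (pred (n T))
  parent′ a = ι⁻¹ (skip≢c (ι a))

  root′ : Fin (pred (n T))
  root′ = ι⁻¹ (c≢root ∘ sym)

  leaf′ : Fin m → Fin (pred (n T))
  leaf′ x = ι⁻¹ (leaf≢c x)

  ι-parent′ : ∀ a → ι (parent′ a) ≡ skip (ι a)
  ι-parent′ a = ι-ι⁻¹ (skip≢c (ι a))

  ι-root′ : ι root′ ≡ root T
  ι-root′ = ι-ι⁻¹ _

  ι-leaf′ : ∀ x → ι (leaf′ x) ≡ leaf T x
  ι-leaf′ x = ι-ι⁻¹ (leaf≢c x)

  ι≢root : ∀ {a} → a ≢ root′ → ι a ≢ root T
  ι≢root a≢root′ ιa≡root = a≢root′ (ι-injective (trans ιa≡root (sym ι-root′)))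

  ≢root′ : ∀ {a} → ι a ≢ root T → a ≢ root′
  ≢root′ ιa≢root refl = ιa≢root ι-root′

  _⪯′_ : Fin (pred (n T)) → Fin (pred (n T)) → Set
  _⪯′_ = Reach parent′

  ⪯′⇒⪯ : ∀ {a b} → a ⪯′ b → _⪯_ T (ι a) (ι b)
  ⪯′⇒⪯ {a} (k , refl) = ι-⪯-iter k
    where
    ι-⪯-iter : ∀ k → _⪯_ T (ι a) (ι (iter parent′ k a))
    ι-⪯-iter zero    = Reach-refl (parent T) (ι a)
    ι-⪯-iter (suc k) = Reach-trans (parent T) (ι-⪯-iter k)
                         (subst (_⪯_ T _) (sym (ι-parent′ _)) (⪯-skip _))

  ⪯⇒⪯′ : ∀ {a b} → _⪯_ T (ι a) (ι b) → a ⪯′ b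
  ⪯⇒⪯′ (j , e) = descend j e
    where
    open ≡-Reasoning
    descend : ∀ j {a b} → iter (parent T) j (ι a) ≡ ι b → a ⪯′ b
    descend zero e = 0 , ι-injective e
    descend (suc j) {a} {b} e with parent T (ι a) ≟ c
    ... | no pa≢c = Reach-step parent′ (descend j (begin
      iter (parent T) j (ι (parent′ a))  ≡⟨ cong (iter (parent T) j) (trans (ι-parent′ a) (skip-≢ pa≢c)) ⟩
      iter (parent T) j (parent T (ι a)) ≡⟨ sym (iter-sucʳ (parent T) j (ι a)) ⟩
      iter (parent T) (suc j) (ι a)      ≡⟨ e ⟩
      ι b                                ∎))
    descend (suc zero)    e | yes pa≡c = contradiction (trans (sym e) pa≡c) (ι≢c _)
    descend (suc (suc j)) {a} {b} e | yes pa≡c = Reach-step parent′ (descend j (begin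
      iter (parent T) j (ι (parent′ a))             ≡⟨ cong (iter (parent T) j) (trans (ι-parent′ a) (skip-≡ pa≡c)) ⟩
      iter (parent T) j (parent T c)                ≡⟨ cong (iter (parent T) j ∘ parent T) (sym pa≡c) ⟩
      iter (parent T) j (parent T (parent T (ι a))) ≡⟨ sym (iter-sucʳ (parent T) j _) ⟩
      iter (parent T) (suc j) (parent T (ι a))      ≡⟨ sym (iter-sucʳ (parent T) (suc j) (ι a)) ⟩
      iter (parent T) (suc (suc j)) (ι a)           ≡⟨ e ⟩
      ι b                                           ∎))

  Child′ : Fin (pred (n T)) → Fin (pred (n T)) → Set
  Child′ w v = (w ≢ root′) × (parent′ w ≡ v)

  child↑ : ∀ {a v} → Child T (ι a) (ι v) → Child′ a v
  child↑ (ιa≢root , pa≡v) =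
    ≢root′ ιa≢root , ι-injective (trans (ι-parent′ _) (trans (skip-≢ (λ pa≡c → ι≢c _ (trans (sym pa≡v) pa≡c))) pa≡v))

  grandchild↑ : ∀ {a v} → Child T (ι a) c → Child T c (ι v) → Child′ a v
  grandchild↑ (ιa≢root , pa≡c) (_ , pc≡v) =
    ≢root′ ιa≢root , ι-injective (trans (ι-parent′ _) (trans (skip-≡ pa≡c) pc≡v))

  child↓ : ∀ {a v} → Child′ a v → Child T (ι a) (ι v) ⊎ (Child T (ι a) c × Child T c (ι v))
  child↓ {a} (a≢root′ , refl) = by-cases (parent T (ι a) ≟ c)
    where
    by-cases : Dec (parent T (ι a) ≡ c) →
               Child T (ι a) (ι (parent′ a)) ⊎ (Child T (ι a) c × Child T c (ι (parent′ a)))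
    by-cases (yes pa≡c) = inj₂ ((ι≢root a≢root′ , pa≡c) , c≢root , sym (trans (ι-parent′ a) (skip-≡ pa≡c)))
    by-cases (no  pa≢c) = inj₁ (ι≢root a≢root′ , sym (trans (ι-parent′ a) (skip-≢ pa≢c)))

  ≢-by-parent : ∀ {a b v} → parent T (ι a) ≡ ι v → parent T (ι b) ≡ c → a ≢ b
  ≢-by-parent pa≡v pb≡c refl = ι≢c _ (trans (sym pa≡v) pb≡c)

  g′ : Fin (pred (n T))
  g′ = ι⁻¹ (child≢parent T g◁c)

  g′◁c : Child T (ι g′) c
  g′◁c = subst (λ w → Child T w c) (sym (ι-ι⁻¹ _)) g◁c

  phylo′ : ∀ v a → Child′ a v → ∃ λ b → Child′ b v × b ≢ a
  phylo′ v a a◁v with child↓ a◁v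
  ... | inj₁ ιa◁ιv with phylo T (ι v) (ι a) ιa◁ιv
  ...   | w , w◁ιv , w≢ιa with w ≟ c
  ...     | yes refl = g′ , grandchild↑ g′◁c w◁ιv , ≢-by-parent (proj₂ ιa◁ιv) (proj₂ g′◁c) ∘ sym
  ...     | no  w≢c with ι-onto w≢c
  ...       | b , refl = b , child↑ w◁ιv , w≢ιa ∘ cong ι
  phylo′ v a a◁v | inj₂ (ιa◁c , c◁ιv) with phylo T (ι v) c c◁ιv
  ... | w , w◁ιv , w≢c with ι-onto w≢c
  ...   | b , refl = b , child↑ w◁ιv , ≢-by-parent (proj₂ w◁ιv) (proj₂ ιa◁c)

  leafIsLeaf′ : ∀ x a → ¬ Child′ a (leaf′ x)
  leafIsLeaf′ x a a◁x = [ (λ ιa◁ιx → leafIsLeaf T x (ι a) (subst (Child T (ι a)) (ι-leaf′ x) ιa◁ιx))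
                        , (λ (_ , c◁ιx) → leafIsLeaf T x c (subst (Child T c) (ι-leaf′ x) c◁ιx)) ]′ (child↓ a◁x)

  leaf↓ : ∀ {v} → (∀ a → ¬ Child′ a v) → IsLeaf T (ι v)
  leaf↓ v-leaf w w◁ιv with w ≟ c
  ... | yes refl = v-leaf g′ (grandchild↑ g′◁c w◁ιv)
  ... | no  w≢c with ι-onto w≢c
  ...   | a , refl = v-leaf a (child↑ w◁ιv)

  T′ : Tree m
  T′ = record
    { n          = pred (n T)
    ; root       = root′
    ; parent     = parent′
    ; parentRoot = ι-injective (begin
        ι (parent′ root′)      ≡⟨ ι-parent′ root′ ⟩
        skip (ι root′)         ≡⟨ cong skip ι-root′ ⟩
        skip (root T)          ≡⟨ skip-≢ (λ pr≡c → c≢root (trans (sym pr≡c) (parentRoot T))) ⟩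
        parent T (root T)      ≡⟨ parentRoot T ⟩
        root T                 ≡⟨ sym ι-root′ ⟩
        ι root′                ∎)
    ; reachRoot  = λ a → ⪯⇒⪯′ (subst (_⪯_ T (ι a)) (sym ι-root′) (reachRoot T (ι a)))
    ; phylo      = phylo′
    ; leaf       = leaf′
    ; leafInj    = λ x y e → leafInj T x y (trans (sym (ι-leaf′ x)) (trans (cong ι e) (ι-leaf′ y)))
    ; leafIsLeaf = leafIsLeaf′
    ; leafSurj   = λ v v-leaf → let (x , e) = leafSurj T (ι v) (leaf↓ v-leaf)
                                in x , ι-injective (trans (ι-leaf′ x) e)
    }
    where open ≡-Reasoning

  contractStep : ContractStep T T′
  contractStep = record
    { c        = c
    ; cNotRoot = c≢root
    ; cInner   = λ c-leaf → c-leaf g g◁c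
    ; e        = ι
    ; eInj     = λ _ _ → ι-injective
    ; eMiss    = ι≢c
    ; eOnto    = λ _ → ι-onto
    ; eRoot    = ι-root′
    ; eLeaf    = ι-leaf′
    ; eParent  = λ a _ → (λ pa≢c → trans (ι-parent′ a) (skip-≢ pa≢c))
                       , (λ pa≡c → trans (ι-parent′ a) (skip-≡ pa≡c))
    }

  leaf⪯⁺ : ∀ {x w} → leaf′ x ⪯′ w → _⪯_ T (leaf T x) (ι w)
  leaf⪯⁺ {x} = subst (λ v → _⪯_ T v _) (ι-leaf′ x) ∘ ⪯′⇒⪯

  leaf⪯⁻ : ∀ {x w} → _⪯_ T (leaf T x) (ι w) → leaf′ x ⪯′ w
  leaf⪯⁻ {x} = ⪯⇒⪯′ ∘ subst (λ v → _⪯_ T v _) (sym (ι-leaf′ x))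

  IsLCA⁺ : ∀ {p z w} → ¬ (_⪯_ T (leaf T p) c × _⪯_ T (leaf T z) c) →
           IsLCA T′ (leaf′ p) (leaf′ z) w → IsLCA T (leaf T p) (leaf T z) (ι w)
  IsLCA⁺ {p} {z} {w} not-both (p⪯w , z⪯w , least) = leaf⪯⁺ p⪯w , leaf⪯⁺ z⪯w , least↑
    where
    least↑ : ∀ V → _⪯_ T (leaf T p) V → _⪯_ T (leaf T z) V → _⪯_ T (ι w) V
    least↑ V p⪯V z⪯V with V ≟ c
    ... | yes refl = contradiction (p⪯V , z⪯V) not-both
    ... | no  V≢c with ι-onto V≢c
    ...   | v , refl = ⪯′⇒⪯ (least v (leaf⪯⁻ p⪯V) (leaf⪯⁻ z⪯V))

  IsLCA⁻ : ∀ {p z w} → IsLCA T (leaf T p) (leaf T z) (ι w) → IsLCA T′ (leaf′ p) (leaf′ z) w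
  IsLCA⁻ (p⪯w , z⪯w , least) =
    leaf⪯⁻ p⪯w , leaf⪯⁻ z⪯w , λ v p⪯v z⪯v → ⪯⇒⪯′ (least (ι v) (leaf⪯⁺ p⪯v) (leaf⪯⁺ z⪯v))

  module _ {u : Fin m → Fin (n T)} (valid : ValidU T u) where

    u≢c : ∀ x → u x ≢ c
    u≢c x with valid x
    ... | inj₁ ux≡x    = leaf≢c x ∘ trans (sym ux≡x)
    ... | inj₂ ux≡root = λ ux≡c → c≢root (trans (sym ux≡c) ux≡root)

    u′ : Fin m → Fin (pred (n T))
    u′ x = ι⁻¹ (u≢c x)

    ι-u′ : ∀ x → ι (u′ x) ≡ u x
    ι-u′ x = ι-ι⁻¹ (u≢c x)

    valid′ : ValidU T′ u′
    valid′ x with valid x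
    ... | inj₁ ux≡x    = inj₁ (ι-injective (trans (ι-u′ x) (trans ux≡x (sym (ι-leaf′ x)))))
    ... | inj₂ ux≡root = inj₂ (ι-injective (trans (ι-u′ x) (trans ux≡root (sym ι-root′))))

    u′≢leaf′ : ∀ x → u x ≢ leaf T x → u′ x ≢ leaf′ x
    u′≢leaf′ x ux≢x u′x≡x = ux≢x (trans (sym (ι-u′ x)) (trans (cong ι u′x≡x) (ι-leaf′ x)))

    u≢leaf : ∀ x → u′ x ≢ leaf′ x → u x ≢ leaf T x
    u≢leaf x u′x≢x ux≡x = u′x≢x (ι-injective (trans (ι-u′ x) (trans ux≡x (sym (ι-leaf′ x)))))

    module _ (σ : Fin m → Bool) (mono : Monochromatic T σ c) where

      not-both-below-c : ∀ {p z} → σ p ≢ σ z → ¬ (_⪯_ T (leaf T p) c × _⪯_ T (leaf T z) c)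
      not-both-below-c σp≢σz (p⪯c , z⪯c) = σp≢σz (mono _ _ p⪯c z⪯c)

      CondA-contract : ∀ {p q} → σ p ≢ σ q → CondA T σ u p q ⇔ CondA T′ σ u′ p q
      CondA-contract {p} {q} σp≢σq = mk⇔
        (λ (ux≢x , below) → u′≢leaf′ p ux≢x , λ z σz≡σq w lca →
          leaf⪯⁻ (below z σz≡σq (ι w) (IsLCA⁺ (p-z-not-both-below-c σz≡σq) lca)))
        (λ (u′x≢x , below′) → u≢leaf p u′x≢x , below↓ below′)
        where
        p-z-not-both-below-c : ∀ {z} → σ z ≡ σ q → ¬ (_⪯_ T (leaf T p) c × _⪯_ T (leaf T z) c)
        p-z-not-both-below-c σz≡σq = not-both-below-c (λ σp≡σz → σp≢σq (trans σp≡σz σz≡σq))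
        below↓ : (∀ z → σ z ≡ σ q → ∀ w → IsLCA T′ (leaf′ p) (leaf′ z) w → leaf′ q ⪯′ w) →
                 ∀ z → σ z ≡ σ q → ∀ W → IsLCA T (leaf T p) (leaf T z) W → _⪯_ T (leaf T q) W
        below↓ below′ z σz≡σq W lca@(p⪯W , z⪯W , _) with W ≟ c
        ... | yes refl = contradiction (p⪯W , z⪯W) (p-z-not-both-below-c σz≡σq)
        ... | no  W≢c with ι-onto W≢c
        ...   | w , refl = leaf⪯⁺ (below′ z σz≡σq w (IsLCA⁻ lca))

      Explains-contract : ∀ {E} → Explains T σ u E → Explains T′ σ u′ E
      Explains-contract (_ , explains) = valid′ , λ x y →
        let (edge⇒ , ⇒edge) = explains x y in
          (λ xy → let (σx≢σy , cond) = edge⇒ xy in σx≢σy , Equivalence.to (cond⇔ σx≢σy) cond)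
        , (λ (σx≢σy , cond′) → ⇒edge (σx≢σy , Equivalence.from (cond⇔ σx≢σy) cond′))
        where
        cond⇔ : ∀ {x y} → σ x ≢ σ y → (CondA T σ u x y ⊎ CondA T σ u y x) ⇔ (CondA T′ σ u′ x y ⊎ CondA T′ σ u′ y x)
        cond⇔ σx≢σy = CondA-contract σx≢σy ⊎-cong CondA-contract (σx≢σy ∘ sym)

avoided-colour⇒Monochromatic : ∀ {m} (T : Tree m) σ {v} b →
  (∀ z → _⪯_ T (leaf T z) v → σ z ≢ b) → Monochromatic T σ v
avoided-colour⇒Monochromatic T σ b avoids p q p⪯v q⪯v =
  trans (¬-not (avoids p p⪯v)) (sym (¬-not (avoids q q⪯v)))

CondA⇒⪯parent : ∀ {m} {T : Tree m} {σ u E} → LeastResolved T σ u E →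
  ∀ {x y} → σ x ≢ σ y → CondA T σ u x y → _⪯_ T (leaf T y) (parent T (leaf T x))
CondA⇒⪯parent {T = T} {σ} {u} ((valid , explains) , least-resolved) {x} {y} σx≢σy (_ , below)
  with ⪯-dec T (leaf T y) (parent T (leaf T x))
... | yes y⪯px = y⪯px
... | no  y⋠px = contradiction (Explains-contract valid σ mono (valid , explains)) (least-resolved T′ (u′ valid) [ contractStep ])
  where
  px≢root : parent T (leaf T x) ≢ root T
  px≢root px≡root = y⋠px (subst (_⪯_ T (leaf T y)) (sym px≡root) (reachRoot T (leaf T y)))

  x≢root : leaf T x ≢ root T
  x≢root x≡root = px≢root (trans (cong (parent T) x≡root) (parentRoot T))

  open Contraction T px≢root (x≢root , refl)

  -- A leaf z of colour σ y below the parent of x would make that parent lca(x, z).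
  mono : Monochromatic T σ (parent T (leaf T x))
  mono = avoided-colour⇒Monochromatic T σ (σ y) λ z z⪯px σz≡σy →
    y⋠px (below z σz≡σy _ (IsLCA-parent T (λ { refl → σx≢σy σz≡σy }) z⪯px))

proposition3p6 : ∀ {m} (T : Tree m) (σ : Fin m → Bool) (u : Fin m → Fin (n T)) (E : Graph m) →
    LeastResolved T σ u E →
    ∀ x y → E x y →
      ((_⪯_ T (leaf T y) (parent T (leaf T x)) × (u x ≢ leaf T x)) ⊎
       (_⪯_ T (leaf T x) (parent T (leaf T y)) × (u y ≢ leaf T y)))
proposition3p6 T σ u E least-resolved x y xy with proj₁ (proj₂ (proj₁ least-resolved) x y) xy
... | σx≢σy , inj₁ condA = inj₁ (CondA⇒⪯parent least-resolved σx≢σy condA , proj₁ condA)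
... | σx≢σy , inj₂ condA = inj₂ (CondA⇒⪯parent least-resolved (σx≢σy ∘ sym) condA , proj₁ condA)
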